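{- For each $n\ge 1$ let $f(n)$ be an integer such that the class $\mathcal{G}_n$ of all $n$-vertex graphs has a distance-vector labelling scheme with labels of at most $f(n)$ bits. Then $f(n)\ge (1-o(1))n$ as $n\to\infty$.
   Context: $d_G(u,v)$ is the distance in $G$ (possibly $\infty$). A distance-vector labelling scheme for a class $\mathcal{C}$ with labels of at most $k$ bits is a function $D:\{0,1\}^*\to(\mathbb{N}\cup\{\infty\})^*$ (from finite binary strings to finite sequences over $\mathbb{N}\cup\{\infty\}$) such that for every $G\in\mathcal{C}$ there exist an ordering $v_1,\dots,v_n$ of $V(G)$ and a function $\ell_G:V(G)\to\{0,1\}^*$ with $|\ell_G(v)|\le k$ for all $v$, such that $D(\ell_G(v))=(d_G(v,v_1),\dots,d_G(v,v_n))$ for every $v\in V(G)$. -}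

module Defs where

open import Data.Nat using (ℕ; zero; suc; _<_; _≤_)
open import Data.Bool using (Bool; true; false)
open import Data.Fin using (Fin)
open import Data.List using (List; length; map; allFin)
open import Data.List.Relation.Binary.Pointwise using (Pointwise)
open import Data.Fin.Permutation using (Permutation′; _⟨$⟩ʳ_)
open import Data.Product using (Σ; _×_)
open import Relation.Binary.PropositionalEquality using (_≡_)
open import Relation.Nullary using (¬_)

data ℕ∞ : Set where
  fin : ℕ → ℕ∞
  ∞   : ℕ∞

record Graph (n : ℕ) : Set where
  field
    adj   : Fin n → Fin n → Bool
    sym   : ∀ u v → adj u v ≡ adj v u
    irrefl : ∀ u → adj u u ≡ false
open Graph public

data Walk {n : ℕ} (G : Graph n) : Fin n → Fin n → ℕ → Set where
  here : ∀ {u} → Walk G u u 0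
  step : ∀ {u w v k} → adj G u w ≡ true → Walk G w v k → Walk G u v (suc k)

Dist : {n : ℕ} → Graph n → Fin n → Fin n → ℕ∞ → Set
Dist G u v (fin k) = Walk G u v k × (∀ m → m < k → ¬ Walk G u v m)
Dist G u v ∞       = ∀ m → ¬ Walk G u v m

BitString : Set
BitString = List Bool

HasDVScheme : ℕ → ℕ → Set
HasDVScheme n k =
  Σ (BitString → List ℕ∞) λ D →
    (G : Graph n) →
      Σ (Permutation′ n) λ σ →            -- ordering v_i = σ(i)
        Σ (Fin n → BitString) λ ℓ →
          (∀ v → length (ℓ v) ≤ k) ×
          (∀ v → Pointwise (Dist G v) (map (σ ⟨$⟩ʳ_) (allFin n)) (D (ℓ v)))

{-# OPTIONS --safe #-}
-- Encode m bits b₁ … bₘ by the graph on vertices 0, …, m+1 in which vertex 0 is alone on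
-- level 0, vertex i+1 lies on level 1 + b₁ + … + bᵢ, and two vertices are adjacent iff their
-- levels differ by one. The distance from vertex 0 to any vertex is its level. Whatever
-- ordering a scheme chooses, the distance vector of vertex 0 is a rearrangement of the
-- nondecreasing level sequence, so it determines that sequence and hence the bits. The label
-- of vertex 0 is therefore an injective function from 2ᵐ bit vectors to strings of length at
-- most k, of which there are fewer than 2ᵏ⁺¹; so n ≤ k + 3, and f(n) ≥ n − 3.
module Submission where

open import Defs
open import Data.Nat using (ℕ; zero; suc; _+_; _*_; _∸_; _^_; _≤_; _<_; _≡ᵇ_; z≤n; s≤s)
open import Data.Nat.Properties
open import Data.Nat.Binary.Base using (ℕᵇ; zero; 2[1+_]; 1+[2_]) renaming (toℕ to toℕᵇ)
open import Data.Nat.Binary.Properties using () renaming (toℕ-injective to toℕᵇ-injective)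
open import Data.Bool using (Bool; true; false; _∨_)
open import Data.Bool.Properties using (∨-comm)
open import Data.Fin using (Fin; zero; suc; toℕ; fromℕ<) renaming (_≤_ to _≤ᶠ_)
open import Data.Fin.Properties
  using (toℕ-injective; fromℕ<-injective; injective⇒≤; injective⇒existsPivot)
open import Data.Fin.Permutation using (Permutation′; _⟨$⟩ʳ_; _⟨$⟩ˡ_; flip; _∘ₚ_; inverseʳ)
open import Data.Vec using (Vec; []; _∷_)
open import Data.Vec.Recursive using (Fin[m^n]↔Fin[m]^n)
open import Data.Vec.Recursive.Properties using (↔Vec)
open import Data.List using (List; []; _∷_; length; map; tabulate; allFin)
open import Data.List.Properties using (map-tabulate; ∷-injective)
open import Data.List.Relation.Binary.Pointwise using (Pointwise; []; _∷_)
open import Data.Product using (∃; _,_; proj₁; proj₂)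
open import Data.Empty using (⊥-elim)
open import Function using (_∘_; _↔_; Inverse; Injection)
open import Function.Definitions using (Injective)
open import Function.Properties.Inverse using (↔-trans; ↔⇒↣)
open import Relation.Binary.Core using (_Preserves_⟶_)
open import Relation.Binary.PropositionalEquality
  using (_≡_; _≗_; refl; cong; cong₂; subst; subst₂; module ≡-Reasoning)
  renaming (sym to ≡-sym; trans to ≡-trans)
open import Relation.Nullary using (¬_; yes; no)
open import Relation.Binary.Definitions using (tri<; tri≈; tri>)

Dist-functional : ∀ {n} {G : Graph n} {u v d d′} → Dist G u v d → Dist G u v d′ → d ≡ d′
Dist-functional {d = fin a} {fin b} (walkᵃ , minᵃ) (walkᵇ , minᵇ) with <-cmp a b
... | tri< a<b _ _ = ⊥-elim (minᵇ a a<b walkᵃ)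
... | tri≈ _ refl _ = refl
... | tri> _ _ b<a = ⊥-elim (minᵃ b b<a walkᵇ)
Dist-functional {d = fin a} {∞}     (walkᵃ , _) unreachable = ⊥-elim (unreachable a walkᵃ)
Dist-functional {d = ∞}     {fin b} unreachable (walkᵇ , _) = ⊥-elim (unreachable b walkᵇ)
Dist-functional {d = ∞}     {∞}     _ _ = refl

Pointwise-Dist⇒≡map : ∀ {n} {G : Graph n} {u} {d : Fin n → ℕ∞} → (∀ v → Dist G u v (d v)) →
                      ∀ {vs ds} → Pointwise (Dist G u) vs ds → ds ≡ map d vs
Pointwise-Dist⇒≡map dist []               = refl
Pointwise-Dist⇒≡map dist {v ∷ _} (p ∷ ps) =
  cong₂ _∷_ (Dist-functional p (dist v)) (Pointwise-Dist⇒≡map dist ps)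

Walk-snoc : ∀ {n} {G : Graph n} {u v w k} → Walk G u v k → adj G v w ≡ true → Walk G u w (suc k)
Walk-snoc here         e = step e here
Walk-snoc (step e′ ws) e = step e′ (Walk-snoc ws e)

adjacentLevels : ℕ → ℕ → Bool
adjacentLevels x y = (x ≡ᵇ suc y) ∨ (y ≡ᵇ suc x)

adjacentLevels-irrefl : ∀ x → adjacentLevels x x ≡ false
adjacentLevels-irrefl zero    = refl
adjacentLevels-irrefl (suc x) = adjacentLevels-irrefl x

adjacentLevels-suc : ∀ x → adjacentLevels x (suc x) ≡ true
adjacentLevels-suc zero    = refl
adjacentLevels-suc (suc x) = adjacentLevels-suc x

adjacentLevels⇒≤suc : ∀ x y → adjacentLevels x y ≡ true → y ≤ suc x
adjacentLevels⇒≤suc zero    (suc zero) _ = s≤s z≤n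
adjacentLevels⇒≤suc (suc x) zero       _ = z≤n
adjacentLevels⇒≤suc (suc x) (suc y)    e = s≤s (adjacentLevels⇒≤suc x y e)

module _ {n} (L : Fin n → ℕ) where

  levelGraph : Graph n
  levelGraph = record
    { adj    = λ u v → adjacentLevels (L u) (L v)
    ; sym    = λ u v → ∨-comm (L u ≡ᵇ suc (L v)) (L v ≡ᵇ suc (L u))
    ; irrefl = λ u → adjacentLevels-irrefl (L u)
    }

  walk-level-≤ : ∀ {u v k} → Walk levelGraph u v k → L v ≤ L u + k
  walk-level-≤ {u} here = m≤m+n (L u) 0
  walk-level-≤ {u} {v} (step {w = w} {k = k} e ws) = begin
    L v            ≤⟨ walk-level-≤ ws ⟩
    L w + k        ≤⟨ +-monoˡ-≤ k (adjacentLevels⇒≤suc (L u) (L w) e) ⟩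
    suc (L u) + k  ≡⟨ +-suc (L u) k ⟨
    L u + suc k    ∎
    where open ≤-Reasoning

  module _ (r : Fin n) (root-level : L r ≡ 0) (root-unique : ∀ u → L u ≡ 0 → u ≡ r)
           (lower-neighbour : ∀ u {k} → L u ≡ suc k → ∃ λ w → L w ≡ k) where

    walk-from-root : ∀ k u → L u ≡ k → Walk levelGraph r u k
    walk-from-root zero u e rewrite root-unique u e = here
    walk-from-root (suc k) u e with lower-neighbour u e
    ... | w , Lw≡k = Walk-snoc (walk-from-root k w Lw≡k)
      (subst₂ (λ x y → adjacentLevels x y ≡ true) (≡-sym Lw≡k) (≡-sym e) (adjacentLevels-suc k))

    Dist-level : ∀ u → Dist levelGraph r u (fin (L u))
    Dist-level u = walk-from-root (L u) u refl , shorter-walk-impossible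
      where
      shorter-walk-impossible : ∀ k → k < L u → ¬ Walk levelGraph r u k
      shorter-walk-impossible k k<L ws = <⇒≱ k<L (subst (λ x → L u ≤ x + k) root-level (walk-level-≤ ws))

Monotone : ∀ {n} → (Fin n → ℕ) → Set
Monotone L = L Preserves _≤ᶠ_ ⟶ _≤_

monotone-rearrangement-≤ : ∀ {n} {L L′ : Fin n → ℕ} {π : Fin n → Fin n} →
  Monotone L → Monotone L′ → Injective _≡_ _≡_ π → L ≗ L′ ∘ π → ∀ i → L′ i ≤ L i
monotone-rearrangement-≤ {L = L} {L′} {π} L↗ L′↗ π-injective L≗L′∘π i
  with injective⇒existsPivot π-injective i
... | j , j≤i , i≤πj = begin
  L′ i      ≤⟨ L′↗ i≤πj ⟩
  L′ (π j)  ≡⟨ L≗L′∘π j ⟨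
  L j       ≤⟨ L↗ j≤i ⟩
  L i       ∎
  where open ≤-Reasoning

monotone-rearrangement-unique : ∀ {n} {L L′ : Fin n → ℕ} (π : Permutation′ n) →
  Monotone L → Monotone L′ → L ≗ L′ ∘ (π ⟨$⟩ʳ_) → L ≗ L′
monotone-rearrangement-unique {L = L} {L′} π L↗ L′↗ L≗L′∘π i = ≤-antisym
  (monotone-rearrangement-≤ L′↗ L↗ (Injection.injective (↔⇒↣ (flip π))) L′≗L∘π⁻¹ i)
  (monotone-rearrangement-≤ L↗ L′↗ (Injection.injective (↔⇒↣ π)) L≗L′∘π i)
  where
  L′≗L∘π⁻¹ : L′ ≗ L ∘ (π ⟨$⟩ˡ_)
  L′≗L∘π⁻¹ j = ≡-trans (cong L′ (≡-sym (inverseʳ π))) (≡-sym (L≗L′∘π (π ⟨$⟩ˡ j)))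

prefixSum : ∀ {m} → ℕ → Vec (Fin 2) m → Fin (suc m) → ℕ
prefixSum c bs       zero    = c
prefixSum c (b ∷ bs) (suc i) = prefixSum (toℕ b + c) bs i

prefixSum-≥ : ∀ {m} c (bs : Vec (Fin 2) m) i → c ≤ prefixSum c bs i
prefixSum-≥ c bs       zero    = ≤-refl
prefixSum-≥ c (b ∷ bs) (suc i) = ≤-trans (m≤n+m c (toℕ b)) (prefixSum-≥ (toℕ b + c) bs i)

prefixSum-monotone : ∀ {m} c (bs : Vec (Fin 2) m) → Monotone (prefixSum c bs)
prefixSum-monotone c bs       {zero}  {j}     _        = prefixSum-≥ c bs j
prefixSum-monotone c (b ∷ bs) {suc i} {suc j} (s≤s i≤j) = prefixSum-monotone (toℕ b + c) bs i≤j

prefixSum-gapless : ∀ {m} c (bs : Vec (Fin 2) m) i {k} → c ≤ k → k ≤ prefixSum c bs i →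
                    ∃ λ j → prefixSum c bs j ≡ k
prefixSum-gapless c bs              zero    c≤k k≤c = zero , ≤-antisym c≤k k≤c
prefixSum-gapless c (zero ∷ bs)     (suc i) c≤k k≤s =
  let j , e = prefixSum-gapless c bs i c≤k k≤s in suc j , e
prefixSum-gapless c (suc zero ∷ bs) (suc i) {k} c≤k k≤s with c ≟ k
... | yes refl = zero , refl
... | no c≢k   = let j , e = prefixSum-gapless (suc c) bs i (≤∧≢⇒< c≤k c≢k) k≤s in suc j , e

prefixSum-injective : ∀ {m} c {bs bs′ : Vec (Fin 2) m} → prefixSum c bs ≗ prefixSum c bs′ → bs ≡ bs′
prefixSum-injective c {[]}     {[]}       _  = refl
prefixSum-injective c {b ∷ bs} {b′ ∷ bs′} eq with toℕ-injective (+-cancelʳ-≡ c _ _ (eq (suc zero)))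
... | refl = cong (b ∷_) (prefixSum-injective (toℕ b + c) (eq ∘ suc))

level : ∀ {m} → Vec (Fin 2) m → Fin (2 + m) → ℕ
level bs zero    = 0
level bs (suc i) = prefixSum 1 bs i

module _ {m} (bs : Vec (Fin 2) m) where

  level-monotone : Monotone (level bs)
  level-monotone {zero}          _         = z≤n
  level-monotone {suc i} {suc j} (s≤s i≤j) = prefixSum-monotone 1 bs i≤j

  level-root-unique : ∀ u → level bs u ≡ 0 → u ≡ zero
  level-root-unique zero    _ = refl
  level-root-unique (suc i) e = ⊥-elim (n≮0 (subst (0 <_) e (prefixSum-≥ 1 bs i)))

  level-lower-neighbour : ∀ u {k} → level bs u ≡ suc k → ∃ λ w → level bs w ≡ k
  level-lower-neighbour (suc i) {zero}  _ = zero , refl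
  level-lower-neighbour (suc i) {suc k} e =
    let j , e′ = prefixSum-gapless 1 bs i (s≤s z≤n) (≤-trans (n≤1+n (suc k)) (≤-reflexive (≡-sym e)))
    in suc j , e′

  Dist-level-from-root : ∀ u → Dist (levelGraph (level bs)) zero u (fin (level bs u))
  Dist-level-from-root = Dist-level (level bs) zero refl level-root-unique level-lower-neighbour

  root-distance-vector : (σ : Permutation′ (2 + m)) {ds : List ℕ∞} →
    Pointwise (Dist (levelGraph (level bs)) zero) (map (σ ⟨$⟩ʳ_) (allFin _)) ds →
    ds ≡ tabulate (fin ∘ level bs ∘ (σ ⟨$⟩ʳ_))
  root-distance-vector σ {ds} pw = begin
    ds                                                ≡⟨ Pointwise-Dist⇒≡map Dist-level-from-root pw ⟩
    map (fin ∘ level bs) (map (σ ⟨$⟩ʳ_) (allFin _))   ≡⟨ cong (map _) (map-tabulate (λ i → i) (σ ⟨$⟩ʳ_)) ⟩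
    map (fin ∘ level bs) (tabulate (σ ⟨$⟩ʳ_))         ≡⟨ map-tabulate (σ ⟨$⟩ʳ_) (fin ∘ level bs) ⟩
    tabulate (fin ∘ level bs ∘ (σ ⟨$⟩ʳ_))             ∎
    where open ≡-Reasoning

level-injective : ∀ {m} {bs bs′ : Vec (Fin 2) m} → level bs ≗ level bs′ → bs ≡ bs′
level-injective eq = prefixSum-injective 1 (eq ∘ suc)

fin-injective : ∀ {a b} → fin a ≡ fin b → a ≡ b
fin-injective refl = refl

tabulate-injective : ∀ {A : Set} {n} {g h : Fin n → A} → tabulate g ≡ tabulate h → g ≗ h
tabulate-injective eq zero    = proj₁ (∷-injective eq)
tabulate-injective eq (suc i) = tabulate-injective (proj₂ (∷-injective eq)) i

root-distance-vector-injective : ∀ {m} {bs bs′ : Vec (Fin 2) m} (σ σ′ : Permutation′ (2 + m)) →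
  tabulate (fin ∘ level bs ∘ (σ ⟨$⟩ʳ_)) ≡ tabulate (fin ∘ level bs′ ∘ (σ′ ⟨$⟩ʳ_)) → bs ≡ bs′
root-distance-vector-injective {bs = bs} {bs′} σ σ′ eq = level-injective
  (monotone-rearrangement-unique (flip σ ∘ₚ σ′) (level-monotone bs) (level-monotone bs′) rearranged)
  where
  same-levels : ∀ i → level bs (σ ⟨$⟩ʳ i) ≡ level bs′ (σ′ ⟨$⟩ʳ i)
  same-levels i = fin-injective
    (tabulate-injective {g = fin ∘ level bs ∘ (σ ⟨$⟩ʳ_)} {h = fin ∘ level bs′ ∘ (σ′ ⟨$⟩ʳ_)} eq i)

  rearranged : ∀ j → level bs j ≡ level bs′ (σ′ ⟨$⟩ʳ (σ ⟨$⟩ˡ j))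
  rearranged j = ≡-trans (cong (level bs) (≡-sym (inverseʳ σ))) (same-levels (σ ⟨$⟩ˡ j))

encode : BitString → ℕᵇ
encode []           = zero
encode (false ∷ xs) = 1+[2 encode xs ]
encode (true  ∷ xs) = 2[1+ encode xs ]

decode : ℕᵇ → BitString
decode zero     = []
decode 1+[2 x ] = false ∷ decode x
decode 2[1+ x ] = true ∷ decode x

decode-encode : ∀ xs → decode (encode xs) ≡ xs
decode-encode []           = refl
decode-encode (false ∷ xs) = cong (false ∷_) (decode-encode xs)
decode-encode (true  ∷ xs) = cong (true ∷_) (decode-encode xs)

encode-injective : Injective _≡_ _≡_ encode
encode-injective {xs} {ys} e = begin
  xs                   ≡⟨ decode-encode xs ⟨
  decode (encode xs)   ≡⟨ cong decode e ⟩
  decode (encode ys)   ≡⟨ decode-encode ys ⟩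
  ys                   ∎
  where open ≡-Reasoning

encode-bound : ∀ xs → 2 + toℕᵇ (encode xs) ≤ 2 ^ suc (length xs)
encode-bound []           = ≤-refl
encode-bound (false ∷ xs) = begin
  3 + 2 * v           ≤⟨ n≤1+n _ ⟩
  2 + (2 + 2 * v)     ≡⟨ cong (2 +_) (*-suc 2 v) ⟨
  2 + 2 * suc v       ≡⟨ *-suc 2 (suc v) ⟨
  2 * (2 + v)         ≤⟨ *-monoʳ-≤ 2 (encode-bound xs) ⟩
  2 ^ suc (length (false ∷ xs)) ∎
  where open ≤-Reasoning; v = toℕᵇ (encode xs)
encode-bound (true ∷ xs)  = begin
  2 + 2 * suc v       ≡⟨ *-suc 2 (suc v) ⟨
  2 * (2 + v)         ≤⟨ *-monoʳ-≤ 2 (encode-bound xs) ⟩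
  2 ^ suc (length (true ∷ xs)) ∎
  where open ≤-Reasoning; v = toℕᵇ (encode xs)

injective-code⇒≤ : ∀ {m k} (code : Vec (Fin 2) m → BitString) → Injective _≡_ _≡_ code →
                   (∀ v → length (code v) ≤ k) → m ≤ suc k
injective-code⇒≤ {m} {k} code code-injective code-short =
  ≮⇒≥ λ 1+k<m → <⇒≱ (^-monoʳ-< 2 (s≤s (s≤s z≤n)) 1+k<m) (injective⇒≤ compress-injective)
  where
  bits : Fin (2 ^ m) ↔ Vec (Fin 2) m
  bits = ↔-trans (Fin[m^n]↔Fin[m]^n 2 m) (↔Vec m)

  index<2^1+k : ∀ i → toℕᵇ (encode (code (Inverse.to bits i))) < 2 ^ suc k
  index<2^1+k i = ≤-trans (n≤1+n _)
    (≤-trans (encode-bound (code (Inverse.to bits i))) (^-monoʳ-≤ 2 (s≤s (code-short _))))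

  compress : Fin (2 ^ m) → Fin (2 ^ suc k)
  compress i = fromℕ< (index<2^1+k i)

  compress-injective : Injective _≡_ _≡_ compress
  compress-injective {i} {j} e = Injection.injective (↔⇒↣ bits) (code-injective (encode-injective
    (toℕᵇ-injective (fromℕ<-injective _ _ (index<2^1+k i) (index<2^1+k j) e))))

DVScheme⇒≤3+ : ∀ {n k} → 2 ≤ n → HasDVScheme n k → n ≤ 3 + k
DVScheme⇒≤3+ {suc (suc m)} {k} (s≤s (s≤s z≤n)) (D , scheme) =
  s≤s (s≤s (injective-code⇒≤ rootLabel rootLabel-injective rootLabel-short))
  where
  ordering : Vec (Fin 2) m → Permutation′ (2 + m)
  ordering bs = proj₁ (scheme (levelGraph (level bs)))

  rootLabel : Vec (Fin 2) m → BitString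
  rootLabel bs = proj₁ (proj₂ (scheme (levelGraph (level bs)))) zero

  rootLabel-short : ∀ bs → length (rootLabel bs) ≤ k
  rootLabel-short bs = proj₁ (proj₂ (proj₂ (scheme (levelGraph (level bs))))) zero

  rootLabel-decodes : ∀ bs → D (rootLabel bs) ≡ tabulate (fin ∘ level bs ∘ (ordering bs ⟨$⟩ʳ_))
  rootLabel-decodes bs =
    root-distance-vector bs (ordering bs) (proj₂ (proj₂ (proj₂ (scheme (levelGraph (level bs))))) zero)

  rootLabel-injective : Injective _≡_ _≡_ rootLabel
  rootLabel-injective {bs} {bs′} e = root-distance-vector-injective (ordering bs) (ordering bs′)
    (≡-trans (≡-sym (rootLabel-decodes bs)) (≡-trans (cong D e) (rootLabel-decodes bs′)))

m≤c+n⇒k*m≤[1+k]*n : ∀ {m n c} k → m ≤ c + n → c * suc k ≤ m → k * m ≤ suc k * n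
m≤c+n⇒k*m≤[1+k]*n {m} {n} {c} k m≤c+n c[1+k]≤m = begin
  k * m          ≤⟨ *-monoʳ-≤ k m≤c+n ⟩
  k * (c + n)    ≡⟨ *-distribˡ-+ k c n ⟩
  k * c + k * n  ≤⟨ +-monoˡ-≤ (k * n) k*c≤n ⟩
  n + k * n      ∎
  where
  open ≤-Reasoning
  k*c≤n : k * c ≤ n
  k*c≤n = subst (_≤ n) (*-comm c k)
    (+-cancelˡ-≤ c (c * k) n (≤-trans (≤-reflexive (≡-sym (*-suc c k))) (≤-trans c[1+k]≤m m≤c+n)))

theorem2p6 : (f : ℕ → ℕ) → (∀ n → 1 ≤ n → HasDVScheme n (f n)) →
    ∀ k → 1 ≤ k → ∃ λ N → ∀ n → N ≤ n → (k ∸ 1) * n ≤ k * f n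
theorem2p6 f scheme (suc k) _ = 3 * suc k , bound
  where
  bound : ∀ n → 3 * suc k ≤ n → k * n ≤ suc k * f n
  bound n 3[1+k]≤n = m≤c+n⇒k*m≤[1+k]*n k (DVScheme⇒≤3+ 2≤n (scheme n (≤-trans (s≤s z≤n) 2≤n))) 3[1+k]≤n
    where
    2≤n : 2 ≤ n
    2≤n = ≤-trans (n≤1+n 2) (≤-trans (*-monoʳ-≤ 3 (s≤s z≤n)) 3[1+k]≤n)
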